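{- Let $P$ be a non-empty set and $\mathcal{L}$ a set of formulae with semantic function $[\![\cdot]\!]:\mathcal{L}\to\mathcal{P}(P)$ such that $\mathcal{L}(p)\neq\emptyset$ for every $p\in P$. Suppose $\mathcal{L}$ features the Boolean connective $\wedge$ and is finitely characterized by $\mathcal{B}$. Then each $p\in P$ has a characteristic formula in $\mathcal{L}$, namely $\chi(p)=\bigwedge_{\phi\in\mathcal{B}(p)}\phi$.
   Context: For $p\in P$, $\mathcal{L}(p)=\{\phi\in\mathcal{L}\mid p\in[\![\phi]\!]\}$. "$\mathcal{L}$ features $\wedge$" means that for all $\phi,\psi\in\mathcal{L}$ there is $\phi\wedge\psi\in\mathcal{L}$ with $[\![\phi\wedge\psi]\!]=[\![\phi]\!]\cap[\![\psi]\!]$; in particular, for a non-empty finite $\Phi\subseteq\mathcal{L}$, $\bigwedge_{\phi\in\Phi}\phi\in\mathcal{L}$ has denotation $\bigcap_{\phi\in\Phi}[\![\phi]\!]$. $\mathcal{L}$ is characterized by $\mathcal{B}:P\to\mathcal{P}(\mathcal{L})$ iff for each $p\in P$: $\emptyset\subsetneq\mathcal{B}(p)\subseteq\mathcal{L}(p)$ and for each $\phi\in\mathcal{L}(p)$, $\bigcap_{\psi\in\mathcal{B}(p)}[\![\psi]\!]\subseteq[\![\phi]\!]$; it is finitely characterized by $\mathcal{B}$ if moreover each $\mathcal{B}(p)$ is finite. A formula $\chi$ is characteristic for $p$ iff for all $q\in P$: $q\in[\![\chi]\!]$ iff $\mathcal{L}(p)\subseteq\mathcal{L}(q)$. -}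

module Defs where

open import Level using (Level; _⊔_; suc)
open import Data.Product using (Σ; _×_; _,_; ∃)
open import Data.List using (List; []; _∷_)
open import Data.List.NonEmpty using (List⁺; _∷_; toList)
open import Data.List.Membership.Propositional using (_∈_)
open import Function.Bundles using (_⇔_)

-- A "logic" over a set of processes P: formulae L and semantics
-- ⟦φ⟧ represented as a predicate on P (a subset of P).
module _ {a b c : Level} {P : Set a} {L : Set b} (⟦_⟧ : L → P → Set c) where

  LOf : P → L → Set c
  LOf p φ = ⟦ φ ⟧ p

  Features∧ : (L → L → L) → Set (a ⊔ b ⊔ c)
  Features∧ _∧_ = ∀ φ ψ q → ⟦ φ ∧ ψ ⟧ q ⇔ (⟦ φ ⟧ q × ⟦ ψ ⟧ q)

  InAll : (L → Set b) → P → Set (b ⊔ c)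
  InAll Φ q = ∀ ψ → Φ ψ → ⟦ ψ ⟧ q

  -- 𝓛 is finitely characterized by 𝓑, where each 𝓑(p) is a finite set,
  -- given as (the set of members of) a list.
  -- Non-emptiness of 𝓑(p) is built into the type List⁺.
  FinitelyCharacterizedBy : (P → List⁺ L) → Set (a ⊔ b ⊔ c)
  FinitelyCharacterizedBy B = ∀ p →
      (∀ ψ → ψ ∈ toList (B p) → LOf p ψ)
    × (∀ φ → LOf p φ → ∀ q → InAll (λ ψ → ψ ∈ toList (B p)) q → ⟦ φ ⟧ q)

  Characteristic : L → P → Set (a ⊔ b ⊔ c)
  Characteristic χ p = ∀ q → ⟦ χ ⟧ q ⇔ (∀ φ → LOf p φ → LOf q φ)

⋀ : {b : Level} {L : Set b} → (L → L → L) → List⁺ L → L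
⋀ {L = L} _∧_ (φ ∷ Φ) = go φ Φ
  where
  go : L → List L → L
  go φ [] = φ
  go φ (ψ ∷ Ψ) = φ ∧ go ψ Ψ

{-# OPTIONS --safe #-}
module Submission where

-- Since ∧ denotes intersection, q satisfies ⋀ 𝓑(p) exactly when q satisfies
-- every formula of 𝓑(p).  As 𝓑(p) ⊆ 𝓛(p) and every formula of 𝓛(p) is
-- implied by 𝓑(p), this happens exactly when 𝓛(p) ⊆ 𝓛(q).

open import Defs
open import Level using (Level)
open import Data.Product using (∃; _,_)
open import Data.List using (List; []; _∷_)
open import Data.List.NonEmpty using (List⁺; _∷_; toList)
open import Data.List.Membership.Propositional using (_∈_)
open import Data.List.Relation.Unary.All as All using (All; []; _∷_)
open import Function.Bundles using (_⇔_; mk⇔; module Equivalence)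
open import Function.Construct.Composition using (_⇔-∘_)

open Equivalence using (to; from)

module _ {a b c : Level} {P : Set a} {L : Set b} (⟦_⟧ : L → P → Set c) where

  ⟦⋀⟧⇔All : (_∧_ : L → L → L) → Features∧ ⟦_⟧ _∧_ →
            ∀ φ Φ q → ⟦ ⋀ _∧_ (φ ∷ Φ) ⟧ q ⇔ All (λ ψ → ⟦ ψ ⟧ q) (φ ∷ Φ)
  ⟦⋀⟧⇔All _∧_ ∧-sem φ [] q = mk⇔ (_∷ []) All.head
  ⟦⋀⟧⇔All _∧_ ∧-sem φ (ψ ∷ Ψ) q =
    mk⇔ (λ h → let hφ , hΨ = to (∧-sem φ _ q) h in hφ ∷ to IH hΨ)
        (λ { (hφ ∷ hΨ) → from (∧-sem φ _ q) (hφ , from IH hΨ) })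
    where
    IH : ⟦ ⋀ _∧_ (ψ ∷ Ψ) ⟧ q ⇔ All (λ χ → ⟦ χ ⟧ q) (ψ ∷ Ψ)
    IH = ⟦⋀⟧⇔All _∧_ ∧-sem ψ Ψ q

  All⇔LOf-⊆ : ∀ {p} (Bp : List L) →
              (∀ ψ → ψ ∈ Bp → LOf ⟦_⟧ p ψ) →
              (∀ φ → LOf ⟦_⟧ p φ → ∀ q → InAll ⟦_⟧ (_∈ Bp) q → ⟦ φ ⟧ q) →
              ∀ q → All (λ ψ → ⟦ ψ ⟧ q) Bp ⇔ (∀ φ → LOf ⟦_⟧ p φ → LOf ⟦_⟧ q φ)
  All⇔LOf-⊆ Bp Bp⊆LOf implied q = mk⇔
    (λ hB φ pφ → implied φ pφ q (λ ψ ψ∈Bp → All.lookup hB ψ∈Bp))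
    (λ p⊆q → All.tabulate (λ ψ∈Bp → p⊆q _ (Bp⊆LOf _ ψ∈Bp)))

mainTheorem11 : {a b c : Level} {P : Set a} {L : Set b}
    (⟦_⟧ : L → P → Set c) →
    P →
    (∀ p → ∃ λ φ → LOf ⟦_⟧ p φ) →
    (_∧_ : L → L → L) → Features∧ ⟦_⟧ _∧_ →
    (B : P → List⁺ L) → FinitelyCharacterizedBy ⟦_⟧ B →
    ∀ p → Characteristic ⟦_⟧ (⋀ _∧_ (B p)) p
mainTheorem11 ⟦_⟧ _ _ _∧_ ∧-sem B characterized p q =
  let B⊆LOf , implied = characterized p in
  All⇔LOf-⊆ ⟦_⟧ (toList (B p)) B⊆LOf implied q ⇔-∘ ⟦⋀⟧⇔All ⟦_⟧ _∧_ ∧-sem _ _ q
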